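{- Let $\varpi=\frac{1}{1168}$, let $x>1$, let $k\geq 4$ be an integer, and let $\nu_1,\dots,\nu_k$ be real numbers with \[ 0\leq \nu_k\leq \nu_{k-1}\leq\cdots\leq \nu_1 \quad\text{and}\quad 1\leq \nu_k+\cdots+\nu_1<1+\frac{\log 2}{\log x}. \] Suppose that $\nu_1<\frac58-8\varpi$ and that for every subset $I\subseteq\{1,2,\dots,k\}$, \[ \sum_{i\in I}\nu_i\notin\Big[\tfrac{3}{8}+8\varpi,\ \tfrac{5}{8}-8\varpi\Big]. \] Then \[ \nu_k+\cdots+\nu_4+\nu_1<\frac{3}{8}+8\varpi+\frac{\log 2}{\log x}. \] -}

module Defs where

open import Level using (Level; _⊔_)
open import Data.Nat as ℕ using (ℕ; zero; suc; z≤n; s≤s)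
open import Data.Nat.Properties using (≤-trans)
open import Data.Fin using (Fin; toℕ; fromℕ<)

open import Data.Fin.Subset using (Subset)
open import Data.Vec using (lookup)
open import Data.Bool using (if_then_else_)
open import Data.Sum using (_⊎_)
open import Relation.Binary.PropositionalEquality using (_≡_; _≢_)
open import Relation.Binary.Structures using (IsStrictTotalOrder)
open import Relation.Nullary.Decidable using (does)
open import Algebra.Structures using (IsCommutativeRing)

-- An ordered field (with propositional equality); ℝ is an instance.
record OrderedField (c ℓ : Level) : Set (Level.suc (c ⊔ ℓ)) where
  infixl 6 _+_
  infixl 7 _*_
  infix 8 -_
  infix 9 _⁻¹
  infix 4 _<_ _≤_
  field
    Carrier : Set c
    _+_ _*_ : Carrier → Carrier → Carrier
    -_ : Carrier → Carrier
    _⁻¹ : Carrier → Carrier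
    0# 1# : Carrier
    _<_ : Carrier → Carrier → Set ℓ
    isCommutativeRing : IsCommutativeRing _≡_ _+_ _*_ -_ 0# 1#
    <-isStrictTotalOrder : IsStrictTotalOrder _≡_ _<_
    0≢1 : 0# ≢ 1#
    ⁻¹-inverse : ∀ x → x ≢ 0# → x * x ⁻¹ ≡ 1#
    +-mono-< : ∀ {x y} z → x < y → x + z < y + z
    *-pos : ∀ {x y} → 0# < x → 0# < y → 0# < x * y

  _≤_ : Carrier → Carrier → Set (c ⊔ ℓ)
  x ≤ y = x < y ⊎ x ≡ y

  fromℕ : ℕ → Carrier
  fromℕ zero = 0#
  fromℕ (suc n) = 1# + fromℕ n

  _/_ : Carrier → Carrier → Carrier
  x / y = x * y ⁻¹

  sumFin : ∀ {k} → (Fin k → Carrier) → Carrier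
  sumFin {zero} f = 0#
  sumFin {suc k} f = f Fin.zero + sumFin (λ i → f (Fin.suc i))

  subsetSum : ∀ {k} → (Fin k → Carrier) → Subset k → Carrier
  subsetSum ν I = sumFin (λ i → if lookup I i then ν i else 0#)

  -- Σ_{i ≥ j} ν i  (0-based index j)
  sumFrom : ∀ {k} → ℕ → (Fin k → Carrier) → Carrier
  sumFrom j ν = sumFin (λ i → if does (j ℕ.≤? toℕ i) then ν i else 0#)

  ϖ : Carrier
  ϖ = 1# / fromℕ 1168

  lowEnd : Carrier
  lowEnd = fromℕ 3 / fromℕ 8 + fromℕ 8 * ϖ

  highEnd : Carrier
  highEnd = fromℕ 5 / fromℕ 8 + - (fromℕ 8 * ϖ)

-- index 0 (i.e. ν₁) in Fin k when 4 ≤ k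
first : ∀ {k} → 4 ℕ.≤ k → Fin k
first hk = fromℕ< (≤-trans (s≤s z≤n) hk)

module Submission where

-- Write a = 3/8 + 8ϖ and b = 5/8 - 8ϖ, so that
-- a + b = 1 and 3a < 2b (with ϖ = 1/1168: a = 446ϖ, b = 722ϖ).
--
--  * A number below b that avoids the gap lies below a (`below-gap`).
--  * If the gap is wide relative to w (a + w < b), then adding numbers
--    ≤ w one at a time to a sum below a can never jump over the gap, so
--    the total stays below a (`accumulate`).
--  * Split Σν = (ν₂ + ν₃) + A with A = ν₁ + ν₄ + ⋯ + ν_k.  If ν₂ + ν₃ ≥ b
--    then A < (a + b + δ) - b = a + δ.  Otherwise ν₂ + ν₃ avoids the gap,
--    so 2ν₃ ≤ ν₂ + ν₃ < a, whence a + ν₃ < b because 3a < 2b (`room`);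
--    starting from ν₁ < a and adding ν₄, …, ν_k (all ≤ ν₃) gives A < a.

open import Defs
open import Level using (_⊔_)
open import Data.Nat as ℕ using (ℕ; zero; suc; s≤s; z≤n)
open import Data.Fin using (Fin; toℕ)
open import Data.Fin.Subset using (Subset; inside; outside) renaming (⊥ to ∅)
open import Data.Product using (_×_; _,_)
open import Data.Sum using (_⊎_; inj₁; inj₂)
open import Data.Vec using (_∷_)
open import Data.Empty using (⊥-elim)
open import Function using (_∘_)
open import Relation.Nullary using (¬_)
open import Relation.Binary.PropositionalEquality
open import Relation.Binary.Definitions using (tri<; tri≈; tri>)
open import Relation.Binary.Bundles using (StrictTotalOrder)
open import Algebra.Bundles using (CommutativeRing)
open import Algebra.Structures using (IsCommutativeRing)
import Algebra.Properties.Ring as RingProperties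
import Algebra.Properties.CommutativeSemigroup as CommutativeSemigroupProperties
import Relation.Binary.Reasoning.StrictPartialOrder as StrictReasoning

module OrderedFieldTheory {c ℓ} (F : OrderedField c ℓ) where
  open OrderedField F

  commutativeRing : CommutativeRing c c
  commutativeRing = record { isCommutativeRing = isCommutativeRing }

  strictTotalOrder : StrictTotalOrder c c ℓ
  strictTotalOrder = record { isStrictTotalOrder = <-isStrictTotalOrder }

  open IsCommutativeRing isCommutativeRing
    using (+-assoc; +-comm; +-identityˡ; +-identityʳ; -‿inverseʳ;
           *-assoc; *-comm; *-identityˡ; *-identityʳ; distribʳ; zeroˡ; zeroʳ)
  open RingProperties (CommutativeRing.ring commutativeRing)
    using (-‿distribʳ-*; -1*x≈-x; -‿involutive)
  open CommutativeSemigroupProperties (CommutativeRing.+-commutativeSemigroup commutativeRing)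
    using (x∙yz≈y∙xz; interchange)
  open StrictTotalOrder strictTotalOrder using (compare; irrefl) renaming (trans to <-trans)
  module <-Reasoning = StrictReasoning (StrictTotalOrder.strictPartialOrder strictTotalOrder)

  <-irrefl : ∀ {x} → ¬ x < x
  <-irrefl = irrefl refl

  ≤⇒≯ : ∀ {x y} → x ≤ y → ¬ y < x
  ≤⇒≯ (inj₁ x<y) y<x = <-irrefl (<-trans x<y y<x)
  ≤⇒≯ (inj₂ refl) x<x = <-irrefl x<x

  <-or-≥ : ∀ x y → x < y ⊎ y ≤ x
  <-or-≥ x y with compare x y
  ... | tri< x<y _ _ = inj₁ x<y
  ... | tri≈ _ x≡y _ = inj₂ (inj₂ (sym x≡y))
  ... | tri> _ _ y<x = inj₂ (inj₁ y<x)

  +-monoʳ-< : ∀ z {x y} → x < y → z + x < z + y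
  +-monoʳ-< z {x} {y} x<y = subst₂ _<_ (+-comm x z) (+-comm y z) (+-mono-< z x<y)

  +-mono-<-≤ : ∀ {x y u v} → x < y → u ≤ v → x + u < y + v
  +-mono-<-≤ {x} {y} {u} x<y (inj₁ u<v) = <-trans (+-mono-< u x<y) (+-monoʳ-< y u<v)
  +-mono-<-≤ {x} {y} {u} x<y (inj₂ refl) = +-mono-< u x<y

  +-mono-≤ : ∀ {x y u v} → x ≤ y → u ≤ v → x + u ≤ y + v
  +-mono-≤ (inj₁ x<y) u≤v = inj₁ (+-mono-<-≤ x<y u≤v)
  +-mono-≤ {x} (inj₂ refl) (inj₁ u<v) = inj₁ (+-monoʳ-< x u<v)
  +-mono-≤ (inj₂ refl) (inj₂ refl) = inj₂ refl

  +-cancel-< : ∀ {x y u v} → y ≤ x → x + u < y + v → u < v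
  +-cancel-< {u = u} {v} y≤x x+u<y+v with <-or-≥ u v
  ... | inj₁ u<v = u<v
  ... | inj₂ v≤u = ⊥-elim (≤⇒≯ (+-mono-≤ y≤x v≤u) x+u<y+v)

  pos-sum : ∀ {x y} → 0# < x → 0# < y → 0# < x + y
  pos-sum {x} {y} 0<x 0<y = subst (_< x + y) (+-identityˡ 0#) (+-mono-<-≤ 0<x (inj₁ 0<y))

  neg-pos : ∀ {x} → x < 0# → 0# < - x
  neg-pos {x} x<0 = subst₂ _<_ (-‿inverseʳ x) (+-identityˡ (- x)) (+-mono-< (- x) x<0)

  0<1 : 0# < 1#
  0<1 with compare 0# 1#
  ... | tri< 0<1 _ _ = 0<1
  ... | tri≈ _ 0≡1 _ = ⊥-elim (0≢1 0≡1)
  ... | tri> _ _ 1<0 = ⊥-elim (<-irrefl (<-trans 1<0 0<1′))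
    where
    -- (-1)·(-1) = 1 is a product of two positive numbers
    0<1′ : 0# < 1#
    0<1′ = subst (0# <_) (trans (-1*x≈-x (- 1#)) (-‿involutive 1#))
                 (*-pos (neg-pos 1<0) (neg-pos 1<0))

  pos-factor : ∀ {x y} → 0# < x → x * y ≡ 1# → 0# < y
  pos-factor {x} {y} 0<x xy≡1 with compare 0# y
  ... | tri< 0<y _ _ = 0<y
  ... | tri≈ _ 0≡y _ = ⊥-elim (0≢1 (trans (sym (zeroʳ x)) (trans (cong (x *_) 0≡y) xy≡1)))
  ... | tri> _ _ y<0 = ⊥-elim (<-irrefl (subst (0# <_) (-‿inverseʳ 1#) (pos-sum 0<1 0<-1)))
    where
    0<-1 : 0# < - 1#
    0<-1 = subst (0# <_) (trans (sym (-‿distribʳ-* x y)) (cong -_ xy≡1)) (*-pos 0<x (neg-pos y<0))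

  ⁻¹-unique : ∀ {x y} → x ≢ 0# → x * y ≡ 1# → x ⁻¹ ≡ y
  ⁻¹-unique {x} {y} x≢0 xy≡1 = begin
    x ⁻¹             ≡⟨ sym (*-identityʳ _) ⟩
    x ⁻¹ * 1#        ≡⟨ cong (x ⁻¹ *_) (sym xy≡1) ⟩
    x ⁻¹ * (x * y)   ≡⟨ sym (*-assoc _ _ _) ⟩
    (x ⁻¹ * x) * y   ≡⟨ cong (_* y) (trans (*-comm _ _) (⁻¹-inverse x x≢0)) ⟩
    1# * y           ≡⟨ *-identityˡ y ⟩
    y                ∎
    where open ≡-Reasoning

  fromℕ-+ : ∀ m n → fromℕ (m ℕ.+ n) ≡ fromℕ m + fromℕ n
  fromℕ-+ zero n = sym (+-identityˡ _)
  fromℕ-+ (suc m) n = trans (cong (1# +_) (fromℕ-+ m n)) (sym (+-assoc 1# _ _))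

  fromℕ-* : ∀ m n → fromℕ (m ℕ.* n) ≡ fromℕ m * fromℕ n
  fromℕ-* zero n = sym (zeroˡ _)
  fromℕ-* (suc m) n = begin
    fromℕ (n ℕ.+ m ℕ.* n)          ≡⟨ fromℕ-+ n (m ℕ.* n) ⟩
    fromℕ n + fromℕ (m ℕ.* n)      ≡⟨ cong₂ _+_ (sym (*-identityˡ _)) (fromℕ-* m n) ⟩
    1# * fromℕ n + fromℕ m * fromℕ n ≡⟨ sym (distribʳ _ 1# (fromℕ m)) ⟩
    (1# + fromℕ m) * fromℕ n       ∎
    where open ≡-Reasoning

  fromℕ-pos : ∀ n → 0# < fromℕ (suc n)
  fromℕ-pos zero = subst (0# <_) (sym (+-identityʳ 1#)) 0<1
  fromℕ-pos (suc n) = pos-sum 0<1 (fromℕ-pos n)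

  fromℕ-suc≢0 : ∀ n → fromℕ (suc n) ≢ 0#
  fromℕ-suc≢0 n n+1≡0 = <-irrefl (subst (0# <_) n+1≡0 (fromℕ-pos n))

  infix 8 _·ϖ
  _·ϖ : ℕ → Carrier
  n ·ϖ = fromℕ n * ϖ

  ·ϖ-+ : ∀ m n → m ·ϖ + n ·ϖ ≡ (m ℕ.+ n) ·ϖ
  ·ϖ-+ m n = trans (sym (distribʳ ϖ _ _)) (cong (_* ϖ) (sym (fromℕ-+ m n)))

  fromℕ*·ϖ : ∀ m n → fromℕ m * n ·ϖ ≡ (m ℕ.* n) ·ϖ
  fromℕ*·ϖ m n = trans (sym (*-assoc _ _ ϖ)) (cong (_* ϖ) (sym (fromℕ-* m n)))

  1168·ϖ : 1168 ·ϖ ≡ 1#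
  1168·ϖ = trans (cong (fromℕ 1168 *_) (*-identityˡ _)) (⁻¹-inverse _ (fromℕ-suc≢0 1167))

  ϖ-pos : 0# < ϖ
  ϖ-pos = pos-factor (fromℕ-pos 1167) 1168·ϖ

  ·ϖ-<-+ : ∀ m d → m ·ϖ < (m ℕ.+ suc d) ·ϖ
  ·ϖ-<-+ m d = subst₂ _<_ (+-identityʳ _) (·ϖ-+ m (suc d))
                 (+-monoʳ-< (m ·ϖ) (*-pos (fromℕ-pos d) ϖ-pos))

  8⁻¹ : fromℕ 8 ⁻¹ ≡ 146 ·ϖ
  8⁻¹ = ⁻¹-unique (fromℕ-suc≢0 7) (trans (fromℕ*·ϖ 8 146) 1168·ϖ)

  lowEnd-ϖ : lowEnd ≡ 446 ·ϖ
  lowEnd-ϖ = begin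
    fromℕ 3 * fromℕ 8 ⁻¹ + fromℕ 8 * ϖ ≡⟨ cong (λ t → fromℕ 3 * t + 8 ·ϖ) 8⁻¹ ⟩
    fromℕ 3 * 146 ·ϖ + 8 ·ϖ            ≡⟨ cong (_+ 8 ·ϖ) (fromℕ*·ϖ 3 146) ⟩
    438 ·ϖ + 8 ·ϖ                      ≡⟨ ·ϖ-+ 438 8 ⟩
    446 ·ϖ                             ∎
    where open ≡-Reasoning

  highEnd-ϖ : highEnd ≡ 722 ·ϖ
  highEnd-ϖ = begin
    fromℕ 5 * fromℕ 8 ⁻¹ + - (8 ·ϖ)   ≡⟨ cong (λ t → fromℕ 5 * t + - (8 ·ϖ)) 8⁻¹ ⟩
    fromℕ 5 * 146 ·ϖ + - (8 ·ϖ)       ≡⟨ cong (_+ - (8 ·ϖ)) (trans (fromℕ*·ϖ 5 146) (sym (·ϖ-+ 722 8))) ⟩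
    (722 ·ϖ + 8 ·ϖ) + - (8 ·ϖ)        ≡⟨ +-assoc _ _ _ ⟩
    722 ·ϖ + (8 ·ϖ + - (8 ·ϖ))        ≡⟨ cong (722 ·ϖ +_) (-‿inverseʳ _) ⟩
    722 ·ϖ + 0#                       ≡⟨ +-identityʳ _ ⟩
    722 ·ϖ                            ∎
    where open ≡-Reasoning

  gap-ends-sum : lowEnd + highEnd ≡ 1#
  gap-ends-sum = trans (cong₂ _+_ lowEnd-ϖ highEnd-ϖ) (trans (·ϖ-+ 446 722) 1168·ϖ)

  gap-wide : (lowEnd + lowEnd) + lowEnd < highEnd + highEnd
  gap-wide = subst₂ _<_ (sym three-low) (sym two-high) (·ϖ-<-+ 1338 105)
    where
    three-low : (lowEnd + lowEnd) + lowEnd ≡ 1338 ·ϖ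
    three-low = trans (cong₂ _+_ (cong₂ _+_ lowEnd-ϖ lowEnd-ϖ) lowEnd-ϖ)
                      (trans (cong (_+ 446 ·ϖ) (·ϖ-+ 446 446)) (·ϖ-+ 892 446))
    two-high : highEnd + highEnd ≡ 1444 ·ϖ
    two-high = trans (cong₂ _+_ highEnd-ϖ highEnd-ϖ) (·ϖ-+ 722 722)

  subsetSum-∅ : ∀ {n} (g : Fin n → Carrier) → subsetSum g ∅ ≡ 0#
  subsetSum-∅ {zero} g = refl
  subsetSum-∅ {suc n} g = trans (+-identityˡ _) (subsetSum-∅ (g ∘ Fin.suc))

  module Gap (a b : Carrier) where

    Avoids : Carrier → Set (c ⊔ ℓ)
    Avoids x = ¬ (a ≤ x × x ≤ b)

    below-gap : ∀ {x} → x < b → Avoids x → x < a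
    below-gap {x} x<b avoids with <-or-≥ x a
    ... | inj₁ x<a = x<a
    ... | inj₂ a≤x = ⊥-elim (avoids (a≤x , inj₁ x<b))

    room : ∀ {x} → (a + a) + a < b + b → x + x < a → a + x < b
    room {x} wide x+x<a with <-or-≥ (a + x) b
    ... | inj₁ a+x<b = a+x<b
    ... | inj₂ b≤a+x = ⊥-elim (≤⇒≯ (+-mono-≤ b≤a+x b≤a+x) (<-trans 2[a+x]<3a wide))
      where
      2[a+x]<3a : (a + x) + (a + x) < (a + a) + a
      2[a+x]<3a = subst (_< (a + a) + a) (interchange a a x x) (+-monoʳ-< (a + a) x+x<a)

    -- Greedy accumulation: starting below the gap and adding terms ≤ w,
    -- where a + w < b, every partial sum p + Σ_{j≤i} g j is below b, hence
    -- (avoiding the gap) below a; so the whole sum stays below a.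
    accumulate : ∀ {n} (g : Fin n → Carrier) {w p : Carrier} →
                 (∀ i → g i ≤ w) → a + w < b →
                 (∀ (I : Subset n) → Avoids (p + subsetSum g I)) →
                 p < a → p + sumFin g < a
    accumulate {zero} g _ _ _ p<a = subst (_< a) (sym (+-identityʳ _)) p<a
    accumulate {suc n} g {w} {p} g≤w a+w<b avoids p<a =
      subst (_< a) (+-assoc p (g Fin.zero) _)
        (accumulate (g ∘ Fin.suc) (g≤w ∘ Fin.suc) a+w<b avoids′ p′<a)
      where
      open <-Reasoning
      p′ : Carrier
      p′ = p + g Fin.zero

      avoids′ : ∀ I → Avoids (p′ + subsetSum (g ∘ Fin.suc) I)
      avoids′ I = subst Avoids (sym (+-assoc p _ _)) (avoids (inside ∷ I))

      p′<b : p′ < b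
      p′<b = begin-strict
        p + g Fin.zero   <⟨ +-mono-<-≤ p<a (g≤w Fin.zero) ⟩
        a + w            <⟨ a+w<b ⟩
        b                ∎

      p′<a : p′ < a
      p′<a = below-gap p′<b (subst Avoids singleton-sum (avoids (inside ∷ ∅)))
        where
        singleton-sum : p + (g Fin.zero + subsetSum (g ∘ Fin.suc) ∅) ≡ p′
        singleton-sum = cong (p +_) (trans (cong (g Fin.zero +_) (subsetSum-∅ (g ∘ Fin.suc))) (+-identityʳ _))

    gap-theorem : (δ : Carrier) → 0# < δ → (a + a) + a < b + b →
                  (n : ℕ) (ν : Fin (3 ℕ.+ n) → Carrier) →
                  (∀ (i j : Fin (3 ℕ.+ n)) → toℕ i ℕ.≤ toℕ j → ν j ≤ ν i) →
                  sumFin ν < (a + b) + δ → ν Fin.zero < b →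
                  (∀ (I : Subset (3 ℕ.+ n)) → Avoids (subsetSum ν I)) →
                  ν Fin.zero + sumFrom 3 ν < a + δ
    gap-theorem δ 0<δ wide n ν antitone sum< ν₁<b avoids =
      subst (λ t → ν₁ + t < a + δ) (sym sumFrom-3) A<a+δ
      where
      -- νᵢ with the 1-based indices of the paper; `tail` is ν₄, …, ν_k.
      ν₁ ν₂ ν₃ : Carrier
      ν₁ = ν Fin.zero
      ν₂ = ν (Fin.suc Fin.zero)
      ν₃ = ν (Fin.suc (Fin.suc Fin.zero))
      tail : Fin n → Carrier
      tail i = ν (Fin.suc (Fin.suc (Fin.suc i)))

      A : Carrier
      A = ν₁ + sumFin tail

      sumFrom-3 : sumFrom 3 ν ≡ sumFin tail
      sumFrom-3 = trans (+-identityˡ _) (trans (+-identityˡ _) (+-identityˡ _))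

      split : sumFin ν ≡ (ν₂ + ν₃) + A
      split = trans (cong (ν₁ +_) (sym (+-assoc ν₂ ν₃ _))) (x∙yz≈y∙xz ν₁ (ν₂ + ν₃) _)

      -- Subset sums of masks starting with inside ∷ outside ∷ outside.
      drop-zeros : ∀ x y → x + (0# + (0# + y)) ≡ x + y
      drop-zeros x y = cong (x +_) (trans (+-identityˡ _) (+-identityˡ y))

      ν₁<a : ν₁ < a
      ν₁<a = below-gap ν₁<b (subst Avoids singleton-sum (avoids (inside ∷ outside ∷ outside ∷ ∅)))
        where
        singleton-sum : ν₁ + (0# + (0# + subsetSum tail ∅)) ≡ ν₁
        singleton-sum = trans (drop-zeros ν₁ _) (trans (cong (ν₁ +_) (subsetSum-∅ tail)) (+-identityʳ ν₁))

      -- Case ν₂ + ν₃ < b: the middle pair avoids the gap, which leaves room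
      -- to accumulate ν₄, …, ν_k onto ν₁ below a.
      A<a : ν₂ + ν₃ < b → A < a
      A<a pair<b = accumulate tail ν₃≥tail (room wide 2ν₃<a) avoids-tail ν₁<a
        where
        pair<a : ν₂ + ν₃ < a
        pair<a = below-gap pair<b (subst Avoids pair-sum (avoids (outside ∷ inside ∷ inside ∷ ∅)))
          where
          pair-sum : 0# + (ν₂ + (ν₃ + subsetSum tail ∅)) ≡ ν₂ + ν₃
          pair-sum = trans (+-identityˡ _)
                       (cong (ν₂ +_) (trans (cong (ν₃ +_) (subsetSum-∅ tail)) (+-identityʳ ν₃)))
        2ν₃<a : ν₃ + ν₃ < a
        2ν₃<a = begin-strict
          ν₃ + ν₃   ≤⟨ +-mono-≤ (antitone (Fin.suc Fin.zero) (Fin.suc (Fin.suc Fin.zero)) (s≤s z≤n)) (inj₂ refl) ⟩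
          ν₂ + ν₃   <⟨ pair<a ⟩
          a         ∎
          where open <-Reasoning
        ν₃≥tail : ∀ i → tail i ≤ ν₃
        ν₃≥tail i = antitone (Fin.suc (Fin.suc Fin.zero)) _ (s≤s (s≤s z≤n))
        avoids-tail : ∀ I → Avoids (ν₁ + subsetSum tail I)
        avoids-tail I = subst Avoids (drop-zeros ν₁ _) (avoids (inside ∷ outside ∷ outside ∷ I))

      -- If ν₂ + ν₃ < b use `A<a`; if ν₂ + ν₃ ≥ b, then Σν < b + (a + δ)
      -- forces A < a + δ.
      A<a+δ : A < a + δ
      A<a+δ with <-or-≥ (ν₂ + ν₃) b
      ... | inj₁ pair<b = <-trans (A<a pair<b) (subst (_< a + δ) (+-identityʳ a) (+-monoʳ-< a 0<δ))
      ... | inj₂ b≤pair = +-cancel-< b≤pair (subst₂ _<_ split regroup sum<)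
        where
        regroup : (a + b) + δ ≡ b + (a + δ)
        regroup = trans (cong (_+ δ) (+-comm a b)) (+-assoc b a δ)

lemma1 : ∀ {c ℓ} (F : OrderedField c ℓ) → let open OrderedField F in
           (δ : Carrier) → 0# < δ →
           (k : ℕ) (hk : 4 ℕ.≤ k) (ν : Fin k → Carrier) →
           (∀ (i : Fin k) → 0# ≤ ν i) →
           (∀ (i j : Fin k) → toℕ i ℕ.≤ toℕ j → ν j ≤ ν i) →
           1# ≤ sumFin ν → sumFin ν < 1# + δ →
           ν (first hk) < highEnd →
           (∀ (I : Subset k) → ¬ (lowEnd ≤ subsetSum ν I × subsetSum ν I ≤ highEnd)) →
           ν (first hk) + sumFrom 3 ν < lowEnd + δ
-- The paper's statement: the gap [3/8 + 8ϖ, 5/8 - 8ϖ] is wide and its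
-- ends sum to 1.
lemma1 F δ 0<δ _ (s≤s (s≤s (s≤s (s≤s {n = m} _)))) ν _ antitone _ sum< ν₁<high avoids =
  Gap.gap-theorem lowEnd highEnd δ 0<δ gap-wide (suc m) ν antitone
    (subst (λ t → sumFin ν < t + δ) (sym gap-ends-sum) sum<) ν₁<high avoids
  where
  open OrderedField F
  open OrderedFieldTheory F using (module Gap; gap-wide; gap-ends-sum)
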